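{- For every finite graph $G$ of order $n(G)$, $\iota_{\rm g}(G)\le \frac{1}{2}n(G)$.
   Context: All graphs are finite and simple; $N[S]$ denotes the closed neighborhood of a vertex set $S$. In the isolation game on $G$, Dominator and Staller alternately choose vertices of $G$, Dominator first; if $S$ is the set of already chosen vertices, a vertex $x$ may be chosen only if it equals or is adjacent to some vertex $y$ lying in a component of $G-N[S]$ that has at least one edge. The game ends when no such vertex exists. Dominator wants to minimize the number of chosen vertices, Staller wants to maximize it. $\iota_{\rm g}(G)$ is the number of chosen vertices under optimal play. -}

module Defs where

open import Data.Nat using (ℕ; zero; suc; ⌊_/2⌋)
open import Data.Fin using (Fin)
open import Data.List using (List; []; _∷_)
open import Data.List.Membership.Propositional using (_∈_)
open import Data.Product using (Σ; ∃; _×_; _,_)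
open import Data.Sum using (_⊎_)
open import Relation.Nullary using (¬_; Dec)
open import Relation.Binary.PropositionalEquality using (_≡_)

-- A finite simple graph on the vertex set Fin n:
-- symmetric, irreflexive (no loops) adjacency relation.
-- (Decidability of adjacency is automatic classically for a finite graph.)
record Graph (n : ℕ) : Set₁ where
  field
    _~_    : Fin n → Fin n → Set
    ~-sym  : ∀ {x y} → x ~ y → y ~ x
    ~-irr  : ∀ {x} → ¬ (x ~ x)
    ~-dec  : ∀ x y → Dec (x ~ y)

module _ {n : ℕ} (G : Graph n) where
  open Graph G

  InN : List (Fin n) → Fin n → Set
  InN S v = ∃ λ u → u ∈ S × (v ≡ u ⊎ u ~ v)

  Out : List (Fin n) → Fin n → Set
  Out S v = ¬ InN S v

  data Reach (S : List (Fin n)) : Fin n → Fin n → Set where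
    here : ∀ {y} → Out S y → Reach S y y
    step : ∀ {y u z} → Out S y → y ~ u → Reach S u z → Reach S y z

  InNontrivComp : List (Fin n) → Fin n → Set
  InNontrivComp S y = ∃ λ z → ∃ λ w → Reach S y z × z ~ w × Out S w

  Legal : List (Fin n) → Fin n → Set
  Legal S x = ∃ λ y → (x ≡ y ⊎ x ~ y) × InNontrivComp S y

  Over : List (Fin n) → Set
  Over S = ∀ x → ¬ Legal S x

  -- DomWins k S : Dominator is to move at position S and can force the game
  -- to end after at most k further moves (whatever Staller does).
  -- StaWins k S : same, but Staller is to move.
  mutual
    data DomWins : ℕ → List (Fin n) → Set where
      d-over : ∀ {k S} → Over S → DomWins k S
      d-move : ∀ {k S} x → Legal S x → StaWins k (x ∷ S) → DomWins (suc k) S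

    data StaWins : ℕ → List (Fin n) → Set where
      s-over : ∀ {k S} → Over S → StaWins k S
      s-move : ∀ {k S} → (∀ x → Legal S x → DomWins k (x ∷ S)) → StaWins (suc k) S

  -- ι_g(G) ≤ k : under optimal play (Dominator first, from the empty position)
  -- Dominator can ensure that at most k vertices are chosen.
  ιg≤ : ℕ → Set
  ιg≤ k = DomWins k []

-- Let W(S) be the number of non-isolated vertices of G − N[S]. A vertex is a legal move
-- exactly when it dominates one of them, so the game is over when W(S) = 0. Dominator plays
-- a vertex of degree at least 2 in G − N[S] if there is one (W drops by at least 3), and
-- otherwise an end of an edge (W drops by at least 2, and G − N[S] keeps maximum degree at
-- most 1). Each Staller move lowers W by at least 1, and by at least 2 when G − N[S] has
-- maximum degree at most 1, because the partner of the vertex she dominates becomes isolated.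
-- By induction on the remaining number of moves, Dominator to move finishes within ⌊W/2⌋
-- moves, Staller to move within ⌈W/2⌉ (within ⌊W/2⌋ under maximum degree at most 1),
-- and W(∅) ≤ n.
module Submission where

open import Defs
open import Data.Nat using (ℕ; zero; suc; _+_; _≤_; _<_; z≤n; s≤s; ⌊_/2⌋; ⌈_/2⌉)
open import Data.Nat.Properties
  using (≤-trans; ≤-pred; m+n≤o⇒m≤o; m≤n⇒m≤1+n; +-monoʳ-<; ≤⇒≯; ⌊n/2⌋-mono; ⌊n/2⌋≤⌈n/2⌉)
open import Data.Bool using (if_then_else_)
open import Data.Fin using (Fin; zero; suc)
open import Data.Fin.Properties using (_≟_; any?)
open import Data.List using (List; []; _∷_; length)
open import Data.List.Membership.Propositional using (find; lose)
open import Data.List.Relation.Unary.All as All using (All; []; _∷_)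
open import Data.List.Relation.Unary.AllPairs using ([]; _∷_)
open import Data.List.Relation.Unary.Any as Any using (here; there)
open import Data.List.Relation.Unary.Unique.Propositional using (Unique)
open import Data.Product using (∃; _×_; _,_)
open import Data.Sum using (_⊎_; inj₁; inj₂)
open import Function using (id; _∘_)
open import Level using (Level; 0ℓ)
open import Relation.Nullary using (¬_; Dec; yes; no; contradiction)
open import Relation.Nullary.Decidable using (does; map′; ¬?; _×-dec_; _⊎-dec_; decidable-stable)
open import Relation.Unary using (Pred; Decidable; _⊆_; _∪_; _∖_)
open import Relation.Binary.PropositionalEquality using (_≡_; _≢_; refl)

private
  variable
    ℓ ℓ′ : Level
    m : ℕ

count : {P : Pred (Fin m) ℓ} → Decidable P → ℕ
count {m = zero}  P? = 0
count {m = suc m} P? = (if does (P? zero) then suc else id) (count (P? ∘ suc))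

count≤n : {P : Pred (Fin m) ℓ} (P? : Decidable P) → count P? ≤ m
count≤n {m = zero}  P? = z≤n
count≤n {m = suc m} P? with P? zero
... | yes _ = s≤s (count≤n (P? ∘ suc))
... | no _  = m≤n⇒m≤1+n (count≤n (P? ∘ suc))

count-mono : {P : Pred (Fin m) ℓ} {Q : Pred (Fin m) ℓ′} (P? : Decidable P) (Q? : Decidable Q) →
             P ⊆ Q → count P? ≤ count Q?
count-mono {m = zero}  P? Q? P⊆Q = z≤n
count-mono {m = suc m} P? Q? P⊆Q with P? zero | Q? zero
... | yes _  | yes _  = s≤s (count-mono (P? ∘ suc) (Q? ∘ suc) P⊆Q)
... | no _   | yes _  = m≤n⇒m≤1+n (count-mono (P? ∘ suc) (Q? ∘ suc) P⊆Q)
... | no _   | no _   = count-mono (P? ∘ suc) (Q? ∘ suc) P⊆Q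
... | yes px | no ¬qx = contradiction (P⊆Q px) ¬qx

count-strict : {P : Pred (Fin m) ℓ} {Q : Pred (Fin m) ℓ′} (P? : Decidable P) (Q? : Decidable Q) →
               P ⊆ Q → ∀ {x} → Q x → ¬ P x → count P? < count Q?
count-strict {m = suc m} P? Q? P⊆Q {zero} qx ¬px with P? zero | Q? zero
... | yes px | _      = contradiction px ¬px
... | no _   | no ¬qx = contradiction qx ¬qx
... | no _   | yes _  = s≤s (count-mono (P? ∘ suc) (Q? ∘ suc) P⊆Q)
count-strict {m = suc m} P? Q? P⊆Q {suc x} qx ¬px with P? zero | Q? zero
... | yes p₀ | no ¬q₀ = contradiction (P⊆Q p₀) ¬q₀
... | yes _  | yes _  = s≤s (count-strict (P? ∘ suc) (Q? ∘ suc) P⊆Q qx ¬px)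
... | no _   | yes _  = m≤n⇒m≤1+n (count-strict (P? ∘ suc) (Q? ∘ suc) P⊆Q qx ¬px)
... | no _   | no _   = count-strict (P? ∘ suc) (Q? ∘ suc) P⊆Q qx ¬px

length+count≤count : {P : Pred (Fin m) ℓ} {Q : Pred (Fin m) ℓ′} (P? : Decidable P) (Q? : Decidable Q) →
                     P ⊆ Q → ∀ {ys} → Unique ys → All (Q ∖ P) ys → length ys + count P? ≤ count Q?
length+count≤count P? Q? P⊆Q [] [] = count-mono P? Q? P⊆Q
length+count≤count {P = P} {Q = Q} P? Q? P⊆Q {y ∷ ys} (y≢ys ∷ unique) ((qy , ¬py) ∷ rest) =
  ≤-trans (+-monoʳ-< (length ys) (count-strict P? P∪y? inj₁ (inj₂ refl) ¬py))
          (length+count≤count P∪y? Q? P∪y⊆Q unique (All.zipWith outside-P∪y (y≢ys , rest)))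
  where
  P∪y? : Decidable (P ∪ (_≡ y))
  P∪y? x = P? x ⊎-dec (x ≟ y)

  P∪y⊆Q : P ∪ (_≡ y) ⊆ Q
  P∪y⊆Q (inj₁ px)   = P⊆Q px
  P∪y⊆Q (inj₂ refl) = qy

  outside-P∪y : ∀ {z} → y ≢ z × (Q ∖ P) z → (Q ∖ (P ∪ (_≡ y))) z
  outside-P∪y (y≢z , qz , ¬pz) = qz , λ { (inj₁ pz) → ¬pz pz ; (inj₂ refl) → y≢z refl }

⌊n/2⌋≤0⇒n≤1 : ∀ {a} → ⌊ a /2⌋ ≤ 0 → a ≤ 1
⌊n/2⌋≤0⇒n≤1 {zero}        _  = z≤n
⌊n/2⌋≤0⇒n≤1 {suc zero}    _  = s≤s z≤n
⌊n/2⌋≤0⇒n≤1 {suc (suc a)} ()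

⌊n/2⌋-pred : ∀ {a b k} → 2 + a ≤ b → ⌊ b /2⌋ ≤ suc k → ⌊ a /2⌋ ≤ k
⌊n/2⌋-pred 2+a≤b ⌊b/2⌋≤1+k = ≤-pred (≤-trans (⌊n/2⌋-mono 2+a≤b) ⌊b/2⌋≤1+k)

module _ {n : ℕ} (G : Graph n) where
  open Graph G

  Dominates : Fin n → Fin n → Set
  Dominates x y = x ≡ y ⊎ x ~ y

  ResidualEdge : List (Fin n) → Fin n → Fin n → Set
  ResidualEdge S v w = Out G S v × v ~ w × Out G S w

  NonIsolated : List (Fin n) → Pred (Fin n) 0ℓ
  NonIsolated S v = ∃ (ResidualEdge S v)

  Branching : List (Fin n) → Set
  Branching S = ∃ λ v → ∃ λ w → ∃ λ w′ → ResidualEdge S v w × ResidualEdge S v w′ × w ≢ w′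

  InN? : ∀ S → Decidable (InN G S)
  InN? S v = map′ find (λ (u , u∈S , d) → lose u∈S d) (Any.any? (λ u → (v ≟ u) ⊎-dec ~-dec u v) S)

  Out? : ∀ S → Decidable (Out G S)
  Out? S v = ¬? (InN? S v)

  ResidualEdge? : ∀ S v w → Dec (ResidualEdge S v w)
  ResidualEdge? S v w = Out? S v ×-dec ~-dec v w ×-dec Out? S w

  NonIsolated? : ∀ S → Decidable (NonIsolated S)
  NonIsolated? S v = any? (ResidualEdge? S v)

  Branching? : ∀ S → Dec (Branching S)
  Branching? S = any? λ v → any? λ w → any? λ w′ →
    ResidualEdge? S v w ×-dec ResidualEdge? S v w′ ×-dec ¬? (w ≟ w′)

  #NonIsolated : List (Fin n) → ℕ
  #NonIsolated S = count (NonIsolated? S)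

  ~⇒≢ : ∀ {v w} → v ~ w → v ≢ w
  ~⇒≢ v~w refl = ~-irr v~w

  ResidualEdge-sym : ∀ {S v w} → ResidualEdge S v w → ResidualEdge S w v
  ResidualEdge-sym (ov , v~w , ow) = ow , ~-sym v~w , ov

  Out-∷⁻ : ∀ {x S} → Out G (x ∷ S) ⊆ Out G S
  Out-∷⁻ o (u , u∈S , d) = o (u , there u∈S , d)

  ResidualEdge-∷⁻ : ∀ {x S v w} → ResidualEdge (x ∷ S) v w → ResidualEdge S v w
  ResidualEdge-∷⁻ (ov , v~w , ow) = Out-∷⁻ ov , v~w , Out-∷⁻ ow

  NonIsolated-∷⁻ : ∀ {x S} → NonIsolated (x ∷ S) ⊆ NonIsolated S
  NonIsolated-∷⁻ (w , e) = w , ResidualEdge-∷⁻ e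

  ¬Branching-∷⁺ : ∀ {x S} → ¬ Branching S → ¬ Branching (x ∷ S)
  ¬Branching-∷⁺ ¬b (v , w , w′ , e , e′ , w≢w′) =
    ¬b (v , w , w′ , ResidualEdge-∷⁻ e , ResidualEdge-∷⁻ e′ , w≢w′)

  ¬Branching⇒neighbour-unique : ∀ {S v w w′} → ¬ Branching S →
                                ResidualEdge S v w → ResidualEdge S v w′ → w ≡ w′
  ¬Branching⇒neighbour-unique ¬b e e′ = decidable-stable (_ ≟ _) λ w≢w′ → ¬b (_ , _ , _ , e , e′ , w≢w′)

  Dominates⇒¬Out : ∀ {x S y} → Dominates x y → ¬ Out G (x ∷ S) y
  Dominates⇒¬Out (inj₁ refl) o = o (_ , here refl , inj₁ refl)
  Dominates⇒¬Out (inj₂ x~y)  o = o (_ , here refl , inj₂ x~y)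

  Dominates⇒¬NonIsolated : ∀ {x S y} → Dominates x y → ¬ NonIsolated (x ∷ S) y
  Dominates⇒¬NonIsolated d (_ , oy , _) = Dominates⇒¬Out d oy

  Reach⇒Out : ∀ {S y z} → Reach G S y z → Out G S y
  Reach⇒Out (here oy)     = oy
  Reach⇒Out (step oy _ _) = oy

  Legal⇒dominates-NonIsolated : ∀ {S x} → Legal G S x → ∃ λ y → Dominates x y × NonIsolated S y
  Legal⇒dominates-NonIsolated (y , d , _ , w , here oy , y~w , ow)     = y , d , w , oy , y~w , ow
  Legal⇒dominates-NonIsolated (y , d , _ , _ , step oy y~u r , _ , _) = y , d , _ , oy , y~u , Reach⇒Out r

  ResidualEdge⇒Legal : ∀ {S v w} → ResidualEdge S v w → Legal G S v
  ResidualEdge⇒Legal {w = w} (ov , v~w , ow) = _ , inj₁ refl , _ , w , here ov , v~w , ow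

  ¬NonIsolated⇒Over : ∀ {S} → ¬ ∃ (NonIsolated S) → Over G S
  ¬NonIsolated⇒Over ¬ni x legal with Legal⇒dominates-NonIsolated legal
  ... | y , _ , ni = ¬ni (y , ni)

  #NonIsolated-drop : ∀ {x S ys} → Unique ys → All (NonIsolated S ∖ NonIsolated (x ∷ S)) ys →
                      length ys + #NonIsolated (x ∷ S) ≤ #NonIsolated S
  #NonIsolated-drop = length+count≤count (NonIsolated? _) (NonIsolated? _) NonIsolated-∷⁻

  legal-drop : ∀ {S x} → Legal G S x → 1 + #NonIsolated (x ∷ S) ≤ #NonIsolated S
  legal-drop legal with Legal⇒dominates-NonIsolated legal
  ... | y , d , ni = #NonIsolated-drop ([] ∷ []) ((ni , Dominates⇒¬NonIsolated d) ∷ [])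

  residualEdge-drop : ∀ {S v w} → ResidualEdge S v w → 2 + #NonIsolated (v ∷ S) ≤ #NonIsolated S
  residualEdge-drop e@(_ , v~w , _) = #NonIsolated-drop ((~⇒≢ v~w ∷ []) ∷ [] ∷ [])
    (((_ , e) , Dominates⇒¬NonIsolated (inj₁ refl)) ∷
     ((_ , ResidualEdge-sym e) , Dominates⇒¬NonIsolated (inj₂ v~w)) ∷ [])

  branching-drop : ∀ {S v w w′} → ResidualEdge S v w → ResidualEdge S v w′ → w ≢ w′ →
                   3 + #NonIsolated (v ∷ S) ≤ #NonIsolated S
  branching-drop e@(_ , v~w , _) e′@(_ , v~w′ , _) w≢w′ =
    #NonIsolated-drop ((~⇒≢ v~w ∷ ~⇒≢ v~w′ ∷ []) ∷ (w≢w′ ∷ []) ∷ [] ∷ [])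
      (((_ , e) , Dominates⇒¬NonIsolated (inj₁ refl)) ∷
       ((_ , ResidualEdge-sym e) , Dominates⇒¬NonIsolated (inj₂ v~w)) ∷
       ((_ , ResidualEdge-sym e′) , Dominates⇒¬NonIsolated (inj₂ v~w′)) ∷ [])

  -- The residual neighbour z of the dominated vertex y has no other residual neighbour, so z
  -- becomes isolated.
  legal-drop-¬Branching : ∀ {S x} → ¬ Branching S → Legal G S x →
                          2 + #NonIsolated (x ∷ S) ≤ #NonIsolated S
  legal-drop-¬Branching {S} {x} ¬b legal with Legal⇒dominates-NonIsolated legal
  ... | y , d , z , e@(_ , y~z , _) = #NonIsolated-drop ((~⇒≢ y~z ∷ []) ∷ [] ∷ [])
    (((z , e) , Dominates⇒¬NonIsolated d) ∷ ((y , ResidualEdge-sym e) , z-isolated) ∷ [])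
    where
    z-isolated : ¬ NonIsolated (x ∷ S) z
    z-isolated (u , e′@(_ , _ , ou))
      with ¬Branching⇒neighbour-unique ¬b (ResidualEdge-sym e) (ResidualEdge-∷⁻ e′)
    ... | refl = Dominates⇒¬Out d ou

  #NonIsolated≤1⇒Over : ∀ {S} → #NonIsolated S ≤ 1 → Over G S
  #NonIsolated≤1⇒Over #≤1 = ¬NonIsolated⇒Over λ (_ , _ , e) → ≤⇒≯ #≤1 (m+n≤o⇒m≤o 2 (residualEdge-drop e))

  mutual
    dominatorWins : ∀ k S → ⌊ #NonIsolated S /2⌋ ≤ k → DomWins G k S
    dominatorWins zero    S h = d-over (#NonIsolated≤1⇒Over (⌊n/2⌋≤0⇒n≤1 h))
    dominatorWins (suc k) S h with Branching? S | any? (NonIsolated? S)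
    ... | yes (v , _ , _ , e , e′ , w≢w′) | _ =
      d-move v (ResidualEdge⇒Legal e) (stallerWins k (v ∷ S) (⌊n/2⌋-pred (branching-drop e e′ w≢w′) h))
    ... | no ¬b | yes (v , _ , e) =
      d-move v (ResidualEdge⇒Legal e)
        (stallerWins-¬Branching k (v ∷ S) (¬Branching-∷⁺ ¬b) (⌊n/2⌋-pred (residualEdge-drop e) h))
    ... | no _  | no ¬ni = d-over (¬NonIsolated⇒Over ¬ni)

    stallerWins : ∀ k S → ⌈ #NonIsolated S /2⌉ ≤ k → StaWins G k S
    stallerWins zero    S h = s-over (#NonIsolated≤1⇒Over (⌊n/2⌋≤0⇒n≤1 (≤-trans (⌊n/2⌋≤⌈n/2⌉ _) h)))
    stallerWins (suc k) S h =
      s-move λ x legal → dominatorWins k (x ∷ S) (⌊n/2⌋-pred (s≤s (legal-drop legal)) h)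

    stallerWins-¬Branching : ∀ k S → ¬ Branching S → ⌊ #NonIsolated S /2⌋ ≤ k → StaWins G k S
    stallerWins-¬Branching zero    S _  h = s-over (#NonIsolated≤1⇒Over (⌊n/2⌋≤0⇒n≤1 h))
    stallerWins-¬Branching (suc k) S ¬b h =
      s-move λ x legal → dominatorWins k (x ∷ S) (⌊n/2⌋-pred (legal-drop-¬Branching ¬b legal) h)

theorem3p2 : (n : ℕ) (G : Graph n) → ιg≤ G ⌊ n /2⌋
theorem3p2 n G = dominatorWins G ⌊ n /2⌋ [] (⌊n/2⌋-mono (count≤n (NonIsolated? G [])))
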